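{- Let $m$ be a deficient number and let $p$ be a prime dividing $m$ with $p^\alpha\,\|\,m$. Then: (a) if $p\,\sigma(p^\alpha)<c(m)$, then $mp$ is abundant; (b) if $p\,\sigma(p^\alpha)=c(m)$, then $mp$ is perfect; (c) if $p\,\sigma(p^\alpha)>c(m)$, then $mp$ is deficient.
   Context: For $n\in\mathbb{N}$, $\sigma(n)=\sum_{d\mid n}d$. $n$ is deficient if $\sigma(n)<2n$, perfect if $\sigma(n)=2n$, abundant if $\sigma(n)>2n$. The deficiency is $d(n)=2n-\sigma(n)$ and the center is $c(n)=\sigma(n)/d(n)$. $p^\alpha\,\|\,m$ means $p^\alpha\mid m$ and $p^{\alpha+1}\nmid m$. -}

module Defs where

open import Data.Nat using (ℕ; suc; _+_; _*_; _∸_; _^_; _<_; >-nonZero)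
open import Data.Nat.Divisibility using (_∣_; _∣?_)
open import Data.Nat.Properties using (m<n⇒0<n∸m)
open import Data.List using (List; filter; map; upTo)
open import Data.Nat.ListAction using (sum)
open import Data.Integer using (+_)
open import Data.Rational using (ℚ; _/_)
open import Relation.Binary.PropositionalEquality using (_≡_)

σ : ℕ → ℕ
σ n = sum (filter (_∣? n) (map suc (upTo n)))

Deficient : ℕ → Set
Deficient n = σ n < 2 * n

Perfect : ℕ → Set
Perfect n = σ n ≡ 2 * n

Abundant : ℕ → Set
Abundant n = 2 * n < σ n

-- deficiency d(n) = 2n - σ(n) (meaningful as a natural number for deficient n)
deficiency : ℕ → ℕ
deficiency n = 2 * n ∸ σ n

center : (n : ℕ) → Deficient n → ℚ
center n def = _/_ (+ σ n) (deficiency n) {{>-nonZero (m<n⇒0<n∸m def)}}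

{-# OPTIONS --safe #-}
-- Write m = pᵅk with p ∤ k. The divisors of p·pʲk that are multiples of p are p times the
-- divisors of pʲk, and the others are exactly the divisors of k; hence
-- σ(pʲ⁺¹k) = p·σ(pʲk) + σ(k). By induction on j this gives σ(m) = σ(pᵅ)σ(k), and with j = α
-- it gives σ(mp) = p·σ(m) + σ(k). As 2mp = p·σ(m) + p·d(m), mp is abundant, perfect or
-- deficient according as p·d(m) is <, = or > σ(k); multiplying by σ(pᵅ) > 0 turns this into
-- the comparison of p·σ(pᵅ)·d(m) with σ(m), i.e. of p·σ(pᵅ) with c(m).
module Submission where

open import Defs
open import Data.Nat using (ℕ; zero; suc; _+_; _*_; _^_; _≤_; _<_; z≤n; s≤s; NonZero; ≢-nonZero; >-nonZero; >-nonZero⁻¹; nonTrivial⇒≢1)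
open import Data.Nat.Properties
open import Data.Nat.Divisibility
open import Data.Nat.Primality using (Prime; prime⇒nonZero; prime⇒nonTrivial; prime⇒irreducible)
open import Data.Nat.Coprimality using (Coprime; coprime-divisor)
open import Data.Nat.ListAction using (sum)
open import Data.Nat.ListAction.Properties using (sum-++)
open import Data.List using ([]; _∷_; _++_; _∷ʳ_; filter; map; upTo)
open import Data.List.Properties using (map-++; upTo-∷ʳ)
open import Data.Integer as ℤ using (+_)
open import Data.Integer.Properties using (pos-*; drop‿+<+; +-injective)
open import Data.Rational as ℚ using (_/_; toℚᵘ)
open import Data.Rational.Properties using (toℚᵘ-mono-<; toℚᵘ-cong; toℚᵘ-fromℚᵘ)
open import Data.Rational.Unnormalised using (mkℚᵘ; *<*; *≡*) renaming (_≃_ to _≃ᵘ_)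
open import Data.Rational.Unnormalised.Properties using (<-respʳ-≃; <-respˡ-≃; ≃-sym; ≃-trans)
open import Algebra.Properties.CommutativeSemigroup +-commutativeSemigroup using (interchange)
open import Algebra.Properties.CommutativeSemigroup *-commutativeSemigroup using (x∙yz≈y∙xz)
open import Data.Sum using (inj₁; inj₂)
open import Data.Product using (_×_; _,_)
open import Data.Empty using (⊥-elim)
open import Function using (_∘_)
open import Relation.Nullary using (Dec; yes; no; ¬_)
open import Relation.Binary.PropositionalEquality
open ≡-Reasoning

-- ∑[ d ≤ n ] f d = f 1 + ⋯ + f n: the index starts at 1.
∑≤ : ℕ → (ℕ → ℕ) → ℕ
∑≤ zero    f = 0
∑≤ (suc n) f = ∑≤ n f + f (suc n)

infix 5 ∑≤
syntax ∑≤ n (λ d → e) = ∑[ d ≤ n ] e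

∑≤-cong : ∀ n {f g : ℕ → ℕ} → (∀ d → f d ≡ g d) → ∑≤ n f ≡ ∑≤ n g
∑≤-cong zero    f≗g = refl
∑≤-cong (suc n) f≗g = cong₂ _+_ (∑≤-cong n f≗g) (f≗g (suc n))

∑≤-distrib-+ : ∀ n (f g : ℕ → ℕ) → ∑[ d ≤ n ] (f d + g d) ≡ ∑≤ n f + ∑≤ n g
∑≤-distrib-+ zero    f g = refl
∑≤-distrib-+ (suc n) f g = trans (cong (_+ (f (suc n) + g (suc n))) (∑≤-distrib-+ n f g))
                                 (interchange (∑≤ n f) (∑≤ n g) (f (suc n)) (g (suc n)))

*-distribˡ-∑≤ : ∀ c n (f : ℕ → ℕ) → c * ∑≤ n f ≡ ∑[ d ≤ n ] c * f d
*-distribˡ-∑≤ c zero    f = *-zeroʳ c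
*-distribˡ-∑≤ c (suc n) f = trans (*-distribˡ-+ c (∑≤ n f) (f (suc n)))
                                  (cong (_+ c * f (suc n)) (*-distribˡ-∑≤ c n f))

∑≤-zero : ∀ n {f : ℕ → ℕ} → (∀ {d} → 1 ≤ d → d ≤ n → f d ≡ 0) → ∑≤ n f ≡ 0
∑≤-zero zero    f≡0 = refl
∑≤-zero (suc n) f≡0 = cong₂ _+_ (∑≤-zero n (λ 1≤d d≤n → f≡0 1≤d (m≤n⇒m≤1+n d≤n)))
                                (f≡0 (s≤s z≤n) ≤-refl)

∑≤-split : ∀ a b (f : ℕ → ℕ) → ∑≤ (a + b) f ≡ ∑≤ a f + (∑[ j ≤ b ] f (a + j))
∑≤-split a zero    f = trans (cong (λ n → ∑≤ n f) (+-identityʳ a)) (sym (+-identityʳ _))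
∑≤-split a (suc b) f = begin
  ∑≤ (a + suc b) f                          ≡⟨ cong (λ n → ∑≤ n f) (+-suc a b) ⟩
  ∑≤ (a + b) f + f (suc (a + b))            ≡⟨ cong₂ _+_ (∑≤-split a b f) (cong f (sym (+-suc a b))) ⟩
  ∑≤ a f + (∑[ j ≤ b ] f (a + j)) + f (a + suc b) ≡⟨ +-assoc (∑≤ a f) _ _ ⟩
  ∑≤ a f + (∑[ j ≤ suc b ] f (a + j))       ∎

∑≤-extend : ∀ {n N} {f : ℕ → ℕ} → n ≤ N → (∀ {d} → n < d → f d ≡ 0) → ∑≤ N f ≡ ∑≤ n f
∑≤-extend {n} {f = f} n≤N f≡0 with m≤n⇒∃[o]m+o≡n n≤N
... | o , refl = begin
  ∑≤ (n + o) f                    ≡⟨ ∑≤-split n o f ⟩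
  ∑≤ n f + (∑[ j ≤ o ] f (n + j)) ≡⟨ cong (_+_ (∑≤ n f)) (∑≤-zero o (λ 1≤j _ → f≡0 (m<m+n n 1≤j))) ⟩
  ∑≤ n f + 0                      ≡⟨ +-identityʳ (∑≤ n f) ⟩
  ∑≤ n f                          ∎

-- Among p consecutive integers pN+1, …, pN+p only the last is a multiple of p.
∑≤-multiples : ∀ p .{{_ : NonZero p}} N {f : ℕ → ℕ} → (∀ {d} → ¬ p ∣ d → f d ≡ 0) →
               ∑[ d ≤ p * N ] f d ≡ ∑[ t ≤ N ] f (p * t)
∑≤-multiples p zero    {f} f≡0 = cong (λ n → ∑≤ n f) (*-zeroʳ p)
∑≤-multiples p@(suc q) (suc N) {f} f≡0 = begin
  ∑≤ (p * suc N) f                              ≡⟨ cong (λ n → ∑≤ n f) p*[1+N]≡p*N+p ⟩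
  ∑≤ (p * N + p) f                              ≡⟨ ∑≤-split (p * N) p f ⟩
  ∑≤ (p * N) f + ((∑[ j ≤ q ] f (p * N + j)) + f (p * N + p))
      ≡⟨ cong₂ (λ x y → ∑≤ (p * N) f + (x + y)) (∑≤-zero q middle≡0) (cong f (sym p*[1+N]≡p*N+p)) ⟩
  ∑≤ (p * N) f + f (p * suc N)                  ≡⟨ cong (_+ f (p * suc N)) (∑≤-multiples p N f≡0) ⟩
  ∑[ t ≤ suc N ] f (p * t)                      ∎
  where
  p*[1+N]≡p*N+p : p * suc N ≡ p * N + p
  p*[1+N]≡p*N+p = trans (*-suc p N) (+-comm p (p * N))

  middle≡0 : ∀ {j} → 1 ≤ j → j ≤ q → f (p * N + j) ≡ 0
  middle≡0 {suc j} _ j<p = f≡0 (λ p∣ → <⇒≱ (s≤s j<p) (∣⇒≤ (∣m+n∣m⇒∣n p∣ (m∣m*n N))))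

select : ∀ {A : Set} → Dec A → ℕ → ℕ
select (yes _) x = x
select (no _)  _ = 0

reject : ∀ {A : Set} → Dec A → ℕ → ℕ
reject (yes _) _ = 0
reject (no _)  x = x

select-+-reject : ∀ {A : Set} (a : Dec A) x → select a x + reject a x ≡ x
select-+-reject (yes _) x = +-identityʳ x
select-+-reject (no _)  x = refl

select-yes : ∀ {A : Set} (a : Dec A) {x} → A → select a x ≡ x
select-yes (yes _) _ = refl
select-yes (no ¬A) A = ⊥-elim (¬A A)

select-no : ∀ {A : Set} (a : Dec A) {x} → ¬ A → select a x ≡ 0
select-no (yes A) ¬A = ⊥-elim (¬A A)
select-no (no _)  _  = refl

select-cong : ∀ {A B : Set} (a : Dec A) (b : Dec B) {x} → (A → B) → (B → A) → select a x ≡ select b x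
select-cong (yes _) (yes _) _   _   = refl
select-cong (yes A) (no ¬B) A→B _   = ⊥-elim (¬B (A→B A))
select-cong (no ¬A) (yes B) _   B→A = ⊥-elim (¬A (B→A B))
select-cong (no _)  (no _)  _   _   = refl

*-select : ∀ c {A : Set} (a : Dec A) x → c * select a x ≡ select a (c * x)
*-select c (yes _) x = refl
*-select c (no _)  x = *-zeroʳ c

sum∘filter : ∀ {A : ℕ → Set} (A? : ∀ x → Dec (A x)) xs →
             sum (filter A? xs) ≡ sum (map (λ x → select (A? x) x) xs)
sum∘filter A? []       = refl
sum∘filter A? (x ∷ xs) with A? x
... | yes _ = cong (_+_ x) (sum∘filter A? xs)
... | no _  = sum∘filter A? xs

sum-map-suc-upTo : ∀ (f : ℕ → ℕ) n → sum (map f (map suc (upTo n))) ≡ ∑≤ n f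
sum-map-suc-upTo f zero    = refl
sum-map-suc-upTo f (suc n) = begin
  sum (map f (map suc (upTo (suc n))))
    ≡⟨ cong (sum ∘ map f ∘ map suc) (sym (upTo-∷ʳ n)) ⟩
  sum (map f (map suc (upTo n ∷ʳ n)))
    ≡⟨ cong (sum ∘ map f) (map-++ suc (upTo n) (n ∷ [])) ⟩
  sum (map f (map suc (upTo n) ++ suc n ∷ []))
    ≡⟨ cong sum (map-++ f (map suc (upTo n)) (suc n ∷ [])) ⟩
  sum (map f (map suc (upTo n)) ++ f (suc n) ∷ [])
    ≡⟨ sum-++ (map f (map suc (upTo n))) (f (suc n) ∷ []) ⟩
  sum (map f (map suc (upTo n))) + (f (suc n) + 0)
    ≡⟨ cong₂ _+_ (sum-map-suc-upTo f n) (+-identityʳ (f (suc n))) ⟩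
  ∑≤ (suc n) f
    ∎

divisorTerm : ℕ → ℕ → ℕ
divisorTerm n d = select (d ∣? n) d

σ≡∑ : ∀ n → σ n ≡ ∑[ d ≤ n ] divisorTerm n d
σ≡∑ n = begin
  σ n                                       ≡⟨ sum∘filter (_∣? n) (map suc (upTo n)) ⟩
  sum (map (divisorTerm n) (map suc (upTo n))) ≡⟨ sum-map-suc-upTo (divisorTerm n) n ⟩
  ∑[ d ≤ n ] divisorTerm n d                ∎

σ≡∑-beyond : ∀ {n N} .{{_ : NonZero n}} → n ≤ N → σ n ≡ ∑[ d ≤ N ] divisorTerm n d
σ≡∑-beyond {n} n≤N = trans (σ≡∑ n) (sym (∑≤-extend n≤N (λ n<d → select-no (_ ∣? n) (<⇒≱ n<d ∘ ∣⇒≤))))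

divisorTerm-* : ∀ p .{{_ : NonZero p}} n d → divisorTerm (p * n) (p * d) ≡ p * divisorTerm n d
divisorTerm-* p n d = begin
  select (p * d ∣? p * n) (p * d)  ≡⟨ select-cong (p * d ∣? p * n) (d ∣? n) (*-cancelˡ-∣ p) (*-monoʳ-∣ p) ⟩
  select (d ∣? n) (p * d)          ≡⟨ sym (*-select p (d ∣? n) d) ⟩
  p * divisorTerm n d              ∎

-- The divisors of pn that are multiples of p are p times the divisors of n.
σ-*-split : ∀ p .{{_ : NonZero p}} n →
            σ (p * n) ≡ p * σ n + (∑[ d ≤ p * n ] reject (p ∣? d) (divisorTerm (p * n) d))
σ-*-split p n = begin
  σ (p * n)                                    ≡⟨ σ≡∑ (p * n) ⟩
  ∑[ d ≤ p * n ] divisorTerm (p * n) d         ≡⟨ ∑≤-cong (p * n) (λ d → sym (select-+-reject (p ∣? d) _)) ⟩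
  ∑[ d ≤ p * n ] (divisible d + indivisible d) ≡⟨ ∑≤-distrib-+ (p * n) divisible indivisible ⟩
  ∑≤ (p * n) divisible + ∑≤ (p * n) indivisible ≡⟨ cong (_+ ∑≤ (p * n) indivisible) divisible-part ⟩
  p * σ n + ∑≤ (p * n) indivisible              ∎
  where
  divisible indivisible : ℕ → ℕ
  divisible   d = select (p ∣? d) (divisorTerm (p * n) d)
  indivisible d = reject (p ∣? d) (divisorTerm (p * n) d)

  divisible-part : ∑≤ (p * n) divisible ≡ p * σ n
  divisible-part = begin
    ∑≤ (p * n) divisible                 ≡⟨ ∑≤-multiples p n (λ {d} p∤d → select-no (p ∣? d) p∤d) ⟩
    ∑[ t ≤ n ] divisible (p * t)         ≡⟨ ∑≤-cong n (λ t → select-yes (p ∣? p * t) (m∣m*n t)) ⟩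
    ∑[ t ≤ n ] divisorTerm (p * n) (p * t) ≡⟨ ∑≤-cong n (divisorTerm-* p n) ⟩
    ∑[ t ≤ n ] p * divisorTerm n t       ≡⟨ sym (*-distribˡ-∑≤ p n (divisorTerm n)) ⟩
    p * (∑[ t ≤ n ] divisorTerm n t)     ≡⟨ cong (p *_) (sym (σ≡∑ n)) ⟩
    p * σ n                              ∎

prime∤⇒coprime : ∀ {p d} → Prime p → ¬ p ∣ d → Coprime d p
prime∤⇒coprime pp p∤d (e∣d , e∣p) with prime⇒irreducible pp e∣p
... | inj₁ e≡1 = e≡1
... | inj₂ refl = ⊥-elim (p∤d e∣d)

coprime-divisor-^ : ∀ {d p k} → Coprime d p → ∀ j → d ∣ p ^ j * k → d ∣ k
coprime-divisor-^ {d} {k = k} d⊥p zero    d∣k = subst (d ∣_) (*-identityˡ k) d∣k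
coprime-divisor-^ {d} {p} {k} d⊥p (suc j) d∣n =
  coprime-divisor-^ d⊥p j (coprime-divisor d⊥p (subst (d ∣_) (*-assoc p (p ^ j) k) d∣n))

∤⇒nonZero : ∀ {p k} → ¬ p ∣ k → NonZero k
∤⇒nonZero {p} p∤k = ≢-nonZero λ { refl → p∤k (p ∣0) }

reject-divisorTerm : ∀ {p k} → Prime p → ¬ p ∣ k → ∀ j d →
                     reject (p ∣? d) (divisorTerm (p * (p ^ j * k)) d) ≡ divisorTerm k d
reject-divisorTerm {p} {k} pp p∤k j d with p ∣? d
... | yes p∣d = sym (select-no (d ∣? k) (p∤k ∘ ∣-trans p∣d))
... | no  p∤d = select-cong (d ∣? p * (p ^ j * k)) (d ∣? k)
                  (coprime-divisor-^ d⊥p j ∘ coprime-divisor d⊥p)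
                  (λ d∣k → ∣-trans d∣k (∣-trans (n∣m*n (p ^ j)) (n∣m*n p)))
  where
  d⊥p : Coprime d p
  d⊥p = prime∤⇒coprime pp p∤d

σ[p^[1+j]*k] : ∀ {p k} → Prime p → ¬ p ∣ k → ∀ j → σ (p ^ suc j * k) ≡ p * σ (p ^ j * k) + σ k
σ[p^[1+j]*k] {p} {k} pp p∤k j = begin
  σ (p ^ suc j * k)    ≡⟨ cong σ (*-assoc p (p ^ j) k) ⟩
  σ (p * n)            ≡⟨ σ-*-split p n ⟩
  p * σ n + (∑[ d ≤ p * n ] reject (p ∣? d) (divisorTerm (p * n) d))
                       ≡⟨ cong (_+_ (p * σ n)) indivisible-part ⟩
  p * σ n + σ k        ∎
  where
  n : ℕ
  n = p ^ j * k

  instance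
    p≢0 : NonZero p
    p≢0 = prime⇒nonZero pp
    k≢0 : NonZero k
    k≢0 = ∤⇒nonZero p∤k
    pn≢0 : NonZero (p * n)
    pn≢0 = m*n≢0 p n {{p≢0}} {{m*n≢0 (p ^ j) k {{m^n≢0 p j}}}}

  indivisible-part : ∑[ d ≤ p * n ] reject (p ∣? d) (divisorTerm (p * n) d) ≡ σ k
  indivisible-part = begin
    ∑[ d ≤ p * n ] reject (p ∣? d) (divisorTerm (p * n) d)
      ≡⟨ ∑≤-cong (p * n) (reject-divisorTerm pp p∤k j) ⟩
    ∑[ d ≤ p * n ] divisorTerm k d
      ≡⟨ sym (σ≡∑-beyond (∣⇒≤ (∣-trans (n∣m*n (p ^ j)) (n∣m*n p)))) ⟩
    σ k ∎

σ[p^[1+j]] : ∀ {p} → Prime p → ∀ j → σ (p ^ suc j) ≡ p * σ (p ^ j) + 1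
σ[p^[1+j]] {p} pp j = begin
  σ (p ^ suc j)              ≡⟨ cong σ (sym (*-identityʳ (p ^ suc j))) ⟩
  σ (p ^ suc j * 1)          ≡⟨ σ[p^[1+j]*k] pp p∤1 j ⟩
  p * σ (p ^ j * 1) + σ 1    ≡⟨ cong (λ n → p * σ n + 1) (*-identityʳ (p ^ j)) ⟩
  p * σ (p ^ j) + 1          ∎
  where
  p∤1 : ¬ p ∣ 1
  p∤1 p∣1 = nonTrivial⇒≢1 {{prime⇒nonTrivial pp}} (∣1⇒≡1 p∣1)

σ-multiplicative-^ : ∀ {p k} → Prime p → ¬ p ∣ k → ∀ j → σ (p ^ j * k) ≡ σ (p ^ j) * σ k
σ-multiplicative-^ {k = k} pp p∤k zero = trans (cong σ (*-identityˡ k)) (sym (+-identityʳ (σ k)))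
σ-multiplicative-^ {p} {k} pp p∤k (suc j) = begin
  σ (p ^ suc j * k)                  ≡⟨ σ[p^[1+j]*k] pp p∤k j ⟩
  p * σ (p ^ j * k) + σ k            ≡⟨ cong (λ x → p * x + σ k) (σ-multiplicative-^ pp p∤k j) ⟩
  p * (σ (p ^ j) * σ k) + σ k        ≡⟨ cong₂ _+_ (sym (*-assoc p (σ (p ^ j)) (σ k))) (sym (*-identityˡ (σ k))) ⟩
  p * σ (p ^ j) * σ k + 1 * σ k      ≡⟨ sym (*-distribʳ-+ (σ k) (p * σ (p ^ j)) 1) ⟩
  (p * σ (p ^ j) + 1) * σ k          ≡⟨ cong (_* σ k) (sym (σ[p^[1+j]] pp j)) ⟩
  σ (p ^ suc j) * σ k                ∎

n≤σ[n] : ∀ n → n ≤ σ n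
n≤σ[n] zero    = z≤n
n≤σ[n] (suc n) = subst₂ _≤_ (select-yes (suc n ∣? suc n) ∣-refl) (sym (σ≡∑ (suc n)))
                        (m≤n+m (divisorTerm (suc n) (suc n)) (∑≤ n (divisorTerm (suc n))))

σ-nonZero : ∀ n .{{_ : NonZero n}} → NonZero (σ n)
σ-nonZero n = >-nonZero (≤-trans (>-nonZero⁻¹ n) (n≤σ[n] n))

σ[n*p] : ∀ {n p k} → Prime p → ¬ p ∣ k → ∀ j → n ≡ p ^ j * k → σ (n * p) ≡ p * σ n + σ k
σ[n*p] {n} {p} {k} pp p∤k j n≡p^j*k = begin
  σ (n * p)                ≡⟨ cong σ n*p≡p^[1+j]*k ⟩
  σ (p ^ suc j * k)        ≡⟨ σ[p^[1+j]*k] pp p∤k j ⟩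
  p * σ (p ^ j * k) + σ k  ≡⟨ cong (λ m → p * σ m + σ k) (sym n≡p^j*k) ⟩
  p * σ n + σ k            ∎
  where
  n*p≡p^[1+j]*k : n * p ≡ p ^ suc j * k
  n*p≡p^[1+j]*k = begin
    n * p              ≡⟨ *-comm n p ⟩
    p * n              ≡⟨ cong (p *_) n≡p^j*k ⟩
    p * (p ^ j * k)    ≡⟨ sym (*-assoc p (p ^ j) k) ⟩
    p ^ suc j * k      ∎

2*[n*p]≡p*σ+p*deficiency : ∀ n → Deficient n → ∀ p → 2 * (n * p) ≡ p * σ n + p * deficiency n
2*[n*p]≡p*σ+p*deficiency n def p = begin
  2 * (n * p)                    ≡⟨ cong (2 *_) (*-comm n p) ⟩
  2 * (p * n)                    ≡⟨ x∙yz≈y∙xz 2 p n ⟩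
  p * (2 * n)                    ≡⟨ cong (p *_) (sym (m+[n∸m]≡n (<⇒≤ def))) ⟩
  p * (σ n + deficiency n)       ≡⟨ *-distribˡ-+ p (σ n) (deficiency n) ⟩
  p * σ n + p * deficiency n     ∎

σ-vs-2* : ∀ n {x y z} → σ n ≡ x + y → 2 * n ≡ x + z →
          (z < y → Abundant n) × (z ≡ y → Perfect n) × (y < z → Deficient n)
σ-vs-2* n {x} σn≡x+y 2n≡x+z =
    (λ z<y → subst₂ _<_ (sym 2n≡x+z) (sym σn≡x+y) (+-monoʳ-< x z<y))
  , (λ z≡y → trans σn≡x+y (trans (cong (_+_ x) (sym z≡y)) (sym 2n≡x+z)))
  , (λ y<z → subst₂ _<_ (sym σn≡x+y) (sym 2n≡x+z) (+-monoʳ-< x y<z))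

toℚᵘ-/ : ∀ i n → toℚᵘ (i / suc n) ≃ᵘ mkℚᵘ i n
toℚᵘ-/ i n = toℚᵘ-fromℚᵘ (mkℚᵘ i n)

/-<⇒*-< : ∀ a b m n .{{_ : NonZero m}} .{{_ : NonZero n}} → (+ a / m) ℚ.< (+ b / n) → a * n < b * m
/-<⇒*-< a b (suc m) (suc n) a/m<b/n
  with <-respˡ-≃ (toℚᵘ-/ (+ a) m) (<-respʳ-≃ (toℚᵘ-/ (+ b) n) (toℚᵘ-mono-< a/m<b/n))
... | *<* an<bm = drop‿+<+ (subst₂ ℤ._<_ (sym (pos-* a (suc n))) (sym (pos-* b (suc m))) an<bm)

/-≡⇒*-≡ : ∀ a b m n .{{_ : NonZero m}} .{{_ : NonZero n}} → (+ a / m) ≡ (+ b / n) → a * n ≡ b * m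
/-≡⇒*-≡ a b (suc m) (suc n) a/m≡b/n
  with ≃-trans (≃-sym (toℚᵘ-/ (+ a) m)) (≃-trans (toℚᵘ-cong a/m≡b/n) (toℚᵘ-/ (+ b) n))
... | *≡* an≡bm = +-injective (trans (pos-* a (suc n)) (trans an≡bm (sym (pos-* b (suc m)))))

center-vs : ∀ m (def : Deficient m) s S .{{_ : NonZero s}} → σ m ≡ s * S → ∀ p →
            let d = deficiency m in
            ((+ (p * s) / 1) ℚ.< center m def → p * d < S)
          × ((+ (p * s) / 1) ≡ center m def → p * d ≡ S)
          × ((+ (p * s) / 1) ℚ.> center m def → S < p * d)
center-vs m def s S σm≡sS p =
    (λ lt → *-cancelˡ-< s _ _ (subst₂ _<_ (psd≡s[pd]) σm*1≡sS (/-<⇒*-< (p * s) (σ m) 1 d lt)))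
  , (λ eq → *-cancelˡ-≡ _ _ s (trans (sym psd≡s[pd]) (trans (/-≡⇒*-≡ (p * s) (σ m) 1 d eq) σm*1≡sS)))
  , (λ gt → *-cancelˡ-< s _ _ (subst₂ _<_ σm*1≡sS (psd≡s[pd]) (/-<⇒*-< (σ m) (p * s) d 1 gt)))
  where
  d : ℕ
  d = deficiency m
  instance
    d≢0 : NonZero d
    d≢0 = >-nonZero (m<n⇒0<n∸m def)
  psd≡s[pd] : p * s * d ≡ s * (p * d)
  psd≡s[pd] = trans (cong (_* d) (*-comm p s)) (*-assoc s p d)
  σm*1≡sS : σ m * 1 ≡ s * S
  σm*1≡sS = trans (*-identityʳ (σ m)) σm≡sS

proposition2p12 : (m p α : ℕ) → (def : Deficient m) → Prime p → p ∣ m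
    → p ^ α ∣ m → ¬ (p ^ suc α ∣ m)
    → ((+ (p * σ (p ^ α)) / 1) ℚ.< center m def → Abundant (m * p))
    × ((+ (p * σ (p ^ α)) / 1) ≡ center m def → Perfect (m * p))
    × ((+ (p * σ (p ^ α)) / 1) ℚ.> center m def → Deficient (m * p))
proposition2p12 m p α def pp _ (divides k m≡k*p^α) p^[1+α]∤m =
  let abundant , perfect , deficient =
        σ-vs-2* (m * p) (σ[n*p] pp p∤k α m≡p^α*k) (2*[n*p]≡p*σ+p*deficiency m def p)
      pd<S , pd≡S , S<pd = center-vs m def (σ (p ^ α)) (σ k) σm≡sS p
  in  abundant ∘ pd<S , perfect ∘ pd≡S , deficient ∘ S<pd
  where
  m≡p^α*k : m ≡ p ^ α * k
  m≡p^α*k = trans m≡k*p^α (*-comm k (p ^ α))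

  p∤k : ¬ p ∣ k
  p∤k p∣k = p^[1+α]∤m (subst (p ^ suc α ∣_) (sym m≡k*p^α) (*-monoˡ-∣ (p ^ α) p∣k))

  instance
    s≢0 : NonZero (σ (p ^ α))
    s≢0 = σ-nonZero (p ^ α) {{m^n≢0 p α {{prime⇒nonZero pp}}}}

  σm≡sS : σ m ≡ σ (p ^ α) * σ k
  σm≡sS = trans (cong σ m≡p^α*k) (σ-multiplicative-^ pp p∤k α)
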